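{- Let $G$ be a finite, simple, connected, self-centered graph with ${\rm diam}(G)=2$. Then $E_2(G)\geq E_1(G)$, with equality if and only if $G\in\{C_4,C_5\}$.
   Context: For a connected graph $G$ and $v\in V(G)$, $\varepsilon_G(v)=\max_{u\in V(G)} d_G(v,u)$ is the eccentricity; ${\rm diam}(G)=\max_v\varepsilon_G(v)$, ${\rm rad}(G)=\min_v\varepsilon_G(v)$, and $G$ is self-centered if ${\rm diam}(G)={\rm rad}(G)$. $E_1(G)=\sum_{v\in V(G)}\varepsilon_G(v)^2$ and $E_2(G)=\sum_{uv\in E(G)}\varepsilon_G(u)\varepsilon_G(v)$. $C_k$ denotes the cycle on $k$ vertices. -}

module Defs where

open import Data.Bool using (Bool; true; false; _∧_; _∨_; if_then_else_)
open import Data.Nat using (ℕ; zero; suc; _+_; _*_; _⊔_; _⊓_; _≡ᵇ_; _<ᵇ_)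
open import Data.Fin using (Fin; toℕ)
open import Data.List using (List; map; foldr; allFin)
open import Data.Nat.ListAction using (sum)
open import Data.Bool.ListAction using (any)
open import Data.Product using (Σ; _×_; ∃)
open import Function.Bundles using (_↔_; Inverse)
open import Relation.Binary.PropositionalEquality using (_≡_)

record Graph (n : ℕ) : Set where
  field
    adj    : Fin n → Fin n → Bool
    sym    : ∀ u v → adj u v ≡ adj v u
    irrefl : ∀ u → adj u u ≡ false
open Graph public

module _ {n : ℕ} (G : Graph n) where

  vertices : List (Fin n)
  vertices = allFin n

  reach : ℕ → Fin n → Fin n → Bool
  reach zero    u v = toℕ u ≡ᵇ toℕ v
  reach (suc k) u v = reach k u v ∨ any (λ w → reach k u w ∧ adj G w v) vertices

  Connected : Set
  Connected = ∀ u v → ∃ λ k → reach k u v ≡ true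

-- least k < b with f k = true, or b if there is none
μ : (ℕ → Bool) → ℕ → ℕ
μ f zero    = zero
μ f (suc b) = if f zero then zero else suc (μ (λ k → f (suc k)) b)

module _ {n : ℕ} (G : Graph n) where

  -- shortest-path distance (a connected graph on n vertices has all
  -- distances < n, so the bounded search returns the true distance)
  dist : Fin n → Fin n → ℕ
  dist u v = μ (λ k → reach G k u v) n

  ecc : Fin n → ℕ
  ecc v = foldr _⊔_ 0 (map (dist v) (vertices G))

  diam : ℕ
  diam = foldr _⊔_ 0 (map ecc (vertices G))

  -- minimum of the eccentricities (diam ≥ every eccentricity, so using it
  -- as the initial value gives exactly the minimum when n ≥ 1)
  rad : ℕ
  rad = foldr _⊓_ diam (map ecc (vertices G))

  SelfCentered : Set
  SelfCentered = diam ≡ rad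

  E₁ : ℕ
  E₁ = sum (map (λ v → ecc v * ecc v) (vertices G))

  -- sum over edges uv, each unordered edge counted once (u < v)
  E₂ : ℕ
  E₂ = sum (map (λ u → sum (map (λ v →
         if adj G u v ∧ (toℕ u <ᵇ toℕ v) then ecc u * ecc v else 0)
         (vertices G))) (vertices G))

-- adjacency of the cycle C_k on Fin k: i ~ i+1 (mod k)
cycAdj : (k : ℕ) → Fin k → Fin k → Bool
cycAdj k i j =
  (suc (toℕ i) ≡ᵇ toℕ j) ∨ (suc (toℕ j) ≡ᵇ toℕ i) ∨
  ((toℕ i ≡ᵇ 0) ∧ (suc (toℕ j) ≡ᵇ k)) ∨ ((toℕ j ≡ᵇ 0) ∧ (suc (toℕ i) ≡ᵇ k))

IsoCycle : ∀ {n} → Graph n → ℕ → Set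
IsoCycle {n} G k = Σ (Fin n ↔ Fin k) λ f →
  ∀ u v → adj G u v ≡ cycAdj k (Inverse.to f u) (Inverse.to f v)

-- Being self-centred of diameter 2, every vertex has eccentricity 2, so E₁ = 4n and E₂ = 4m
-- where m is the number of edges. Every vertex v has two distinct neighbours: the middle
-- vertex w of a path to a vertex at distance 2 from v, and the first vertex of a path from v
-- to a vertex at distance 2 from w. Hence 2m = Σ deg ≥ 2n, with equality exactly for
-- 2-regular G. If G is 2-regular, the vertices within distance 2 of v are v, its two
-- neighbours and their other neighbours; these are all vertices, a triangle through v is
-- impossible, and what remains is C₄ or C₅. Conversely C₄ and C₅ are 2-regular.
module Submission where

open import Defs renaming (sym to adj-sym)
open import Data.Bool using (Bool; true; false; _∧_; _∨_; not; if_then_else_; T)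
open import Data.Bool.ListAction using (any)
open import Data.Bool.Properties using (∧-identityʳ; ∨-zeroʳ; T-≡; T-∧) renaming (_≟_ to _≟ᵇ_)
open import Data.Empty using (⊥-elim)
open import Data.Fin using (Fin; toℕ) renaming (zero to fzero; suc to fsuc)
open import Data.Fin.Patterns using (0F; 1F; 2F; 3F; 4F)
open import Data.Fin.Properties using (_≟_; toℕ-injective; all?; any?)
open import Data.List using (List; []; _∷_; map; foldr; allFin; tabulate; length; lookup)
open import Data.List.Membership.Propositional using (_∈_)
open import Data.List.Membership.Propositional.Properties
  using (∈-allFin; ∈-map⁻; ∈-lookup; foldr-selective)
open import Data.List.Properties using (map-tabulate)
open import Data.List.Relation.Unary.All as All using (All; []; _∷_)
open import Data.List.Relation.Unary.AllPairs using ([]; _∷_)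
open import Data.List.Relation.Unary.Any as Any using (here; there; satisfied)
open import Data.List.Relation.Unary.Any.Properties using (any⁺; any⁻; lookup-index)
open import Data.List.Relation.Unary.Unique.Propositional using (Unique)
open import Data.Nat
  using (ℕ; zero; suc; _+_; _*_; _⊔_; _⊓_; _≤_; _<_; z≤n; s≤s; _<ᵇ_; NonZero)
open import Data.Nat.DivMod using (_mod_)
open import Data.Nat.ListAction using (sum)
open import Data.Nat.Properties
  using ( +-*-semiring; +-comm; +-identityʳ; *-comm; *-identityʳ; *-zeroʳ
        ; ≤-reflexive; ≤-trans; ≤-antisym; ≤-pred; ≤-<-trans; <⇒≱; n≤0⇒n≡0
        ; m≤n⇒m<n∨m≡n; +-mono-≤; +-monoˡ-≤; +-monoʳ-≤; +-cancelˡ-≤; +-cancelʳ-≤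
        ; *-monoʳ-≤; *-cancelˡ-≤; *-cancelˡ-≡; ⊔-sel; m≤m⊔n; m≤n⊔m; m⊓n≤m; m⊓n≤n
        ; ≡ᵇ⇒≡; ≡⇒≡ᵇ; module ≤-Reasoning)
  renaming (_≟_ to _≟ℕ_)
open import Algebra.Properties.Semiring.Sum +-*-semiring
  using (sum-syntax; sum-cong-≗; ∑-distrib-+; ∑-comm; ∑-permute; *-distribˡ-sum)
open import Data.Product using (_×_; _,_; proj₁; ∃-syntax; ∃₂)
import Data.Product as Product
open import Data.Sum using (_⊎_; inj₁; inj₂; [_,_]′)
open import Function using (_∘_; case_of_)
open import Function.Bundles using (Equivalence; Inverse; _↔_; mk↔ₛ′; _⇔_; mk⇔)
open import Relation.Binary.PropositionalEquality
open import Relation.Nullary using (Dec; yes; no; does; contradiction; ¬?; _×-dec_; _⊎-dec_; _→-dec_)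
open import Relation.Nullary.Decidable using (toWitness)

𝟙 : Bool → ℕ
𝟙 b = if b then 1 else 0

sum-tabulate : ∀ {n} (f : Fin n → ℕ) → sum (tabulate f) ≡ ∑[ i < n ] f i
sum-tabulate {zero}  f = refl
sum-tabulate {suc n} f = cong (f fzero +_) (sum-tabulate (λ i → f (fsuc i)))

sum-map-allFin : ∀ {n} (f : Fin n → ℕ) → sum (map f (allFin n)) ≡ ∑[ i < n ] f i
sum-map-allFin f = trans (cong sum (map-tabulate (λ i → i) f)) (sum-tabulate f)

∑-const : ∀ n c → ∑[ i < n ] c ≡ n * c
∑-const zero    c = refl
∑-const (suc n) c = cong (c +_) (∑-const n c)

∑-mono-≤ : ∀ {n} {f g : Fin n → ℕ} → (∀ i → f i ≤ g i) → ∑[ i < n ] f i ≤ ∑[ i < n ] g i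
∑-mono-≤ {zero}  f≤g = z≤n
∑-mono-≤ {suc n} f≤g = +-mono-≤ (f≤g fzero) (∑-mono-≤ (λ i → f≤g (fsuc i)))

∑-≤-tight : ∀ {n} {f g : Fin n → ℕ} → (∀ i → f i ≤ g i) →
            ∑[ i < n ] f i ≡ ∑[ i < n ] g i → ∀ i → f i ≡ g i
∑-≤-tight {suc n} {f} {g} f≤g eq = λ where
    fzero    → ≤-antisym (f≤g fzero) (+-cancelʳ-≤ _ _ _ g₀+∑f≤f₀+∑f)
    (fsuc i) → ∑-≤-tight (λ i → f≤g (fsuc i)) ∑f≡∑g i
  where
  ∑ₜ : (Fin (suc n) → ℕ) → ℕ
  ∑ₜ h = ∑[ i < n ] h (fsuc i)
  g₀+∑f≤f₀+∑f : g fzero + ∑ₜ f ≤ f fzero + ∑ₜ f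
  g₀+∑f≤f₀+∑f = ≤-trans (+-monoʳ-≤ (g fzero) (∑-mono-≤ (λ i → f≤g (fsuc i)))) (≤-reflexive (sym eq))
  ∑f≡∑g : ∑ₜ f ≡ ∑ₜ g
  ∑f≡∑g = ≤-antisym (∑-mono-≤ (λ i → f≤g (fsuc i)))
            (+-cancelˡ-≤ (g fzero) _ _ (≤-trans (≤-reflexive (sym eq)) (+-monoˡ-≤ _ (f≤g fzero))))

count : ∀ {n} → (Fin n → Bool) → ℕ
count {n} p = ∑[ v < n ] 𝟙 (p v)

count-true : ∀ n → count {n} (λ _ → true) ≡ n
count-true n = trans (∑-const n 1) (*-identityʳ n)

count-≟ : ∀ {n} (q : Fin n) → count (λ v → does (v ≟ q)) ≡ 1
count-≟ {suc n} fzero    = cong suc (trans (∑-const n 0) (*-zeroʳ n))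
count-≟ {suc n} (fsuc q) = count-≟ q

count-remove : ∀ {n} (p : Fin n → Bool) {q} → p q ≡ true →
               count p ≡ suc (count (λ v → p v ∧ not (does (v ≟ q))))
count-remove {n} p {q} pq = begin
  count p                                ≡⟨ sum-cong-≗ {x = λ v → 𝟙 (p v)} split ⟩
  ∑[ v < n ] (𝟙 (p′ v) + 𝟙 (is-q v))     ≡⟨ ∑-distrib-+ (λ v → 𝟙 (p′ v)) (λ v → 𝟙 (is-q v)) ⟩
  count p′ + count is-q                  ≡⟨ cong (count p′ +_) (count-≟ q) ⟩
  count p′ + 1                           ≡⟨ +-comm (count p′) 1 ⟩
  suc (count p′)                         ∎
  where
  open ≡-Reasoning
  is-q p′ : Fin n → Bool
  is-q v = does (v ≟ q)
  p′ v = p v ∧ not (is-q v)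
  split : ∀ v → 𝟙 (p v) ≡ 𝟙 (p′ v) + 𝟙 (is-q v)
  split v with v ≟ q
  ... | yes refl rewrite pq = refl
  ... | no _     rewrite ∧-identityʳ (p v) = sym (+-identityʳ _)

distinct≤count : ∀ {n} (p : Fin n → Bool) {ps : List (Fin n)} → Unique ps →
                 All (λ v → p v ≡ true) ps → length ps ≤ count p
distinct≤count p []             []         = z≤n
distinct≤count p {q ∷ qs} (q≢qs ∷ qs-unique) (pq ∷ pqs) =
  subst (suc (length qs) ≤_) (sym (count-remove p pq))
    (s≤s (distinct≤count _ qs-unique (All.zipWith still-true (q≢qs , pqs))))
  where
  still-true : ∀ {r} → q ≢ r × p r ≡ true → p r ∧ not (does (r ≟ q)) ≡ true
  still-true {r} (q≢r , pr) with r ≟ q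
  ... | yes r≡q = ⊥-elim (q≢r (sym r≡q))
  ... | no _    rewrite pr = refl

≤-max-map : ∀ {A : Set} (f : A → ℕ) {x xs} → x ∈ xs → f x ≤ foldr _⊔_ 0 (map f xs)
≤-max-map f (here refl)              = m≤m⊔n _ _
≤-max-map f {xs = y ∷ _} (there x∈) = ≤-trans (≤-max-map f x∈) (m≤n⊔m (f y) _)

min-map-≤ : ∀ {A : Set} (f : A → ℕ) d {x xs} → x ∈ xs → foldr _⊓_ d (map f xs) ≤ f x
min-map-≤ f d (here refl)              = m⊓n≤m _ _
min-map-≤ f d {xs = y ∷ _} (there x∈) = ≤-trans (m⊓n≤n (f y) _) (min-map-≤ f d x∈)

lookup-injective : ∀ {A : Set} {xs : List A} → Unique xs → ∀ {i j} → lookup xs i ≡ lookup xs j → i ≡ j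
lookup-injective (x∉xs ∷ _) {fzero}  {fzero}  _  = refl
lookup-injective (x∉xs ∷ _) {fzero}  {fsuc j} eq = ⊥-elim (All.lookup x∉xs (∈-lookup j) eq)
lookup-injective (x∉xs ∷ _) {fsuc i} {fzero}  eq = ⊥-elim (All.lookup x∉xs (∈-lookup i) (sym eq))
lookup-injective (_ ∷ xs!)  {fsuc i} {fsuc j} eq = cong fsuc (lookup-injective xs! eq)

enumeration : ∀ {n} (xs : List (Fin n)) → Unique xs → (∀ u → u ∈ xs) → Fin n ↔ Fin (length xs)
enumeration xs xs! complete = mk↔ₛ′ (Any.index ∘ complete) (lookup xs)
  (λ i → lookup-injective xs! (sym (lookup-index (complete (lookup xs i)))))
  (λ u → sym (lookup-index (complete u)))

μ-≤ : ∀ (f : ℕ → Bool) b {k} → f k ≡ true → μ f b ≤ k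
μ-≤ f zero    _ = z≤n
μ-≤ f (suc b) {k} fk with f 0 in f0
... | true = z≤n
μ-≤ f (suc b) {zero}  fk | false = case trans (sym f0) fk of λ ()
μ-≤ f (suc b) {suc k} fk | false = s≤s (μ-≤ (λ j → f (suc j)) b fk)

μ-found : ∀ (f : ℕ → Bool) b → μ f b < b → f (μ f b) ≡ true
μ-found f (suc b) μ<b with f 0 in f0
... | true  = f0
... | false = μ-found (λ j → f (suc j)) b (≤-pred μ<b)

exactly-one-<ᵇ : ∀ {a b} → a ≢ b → 𝟙 (a <ᵇ b) + 𝟙 (b <ᵇ a) ≡ 1
exactly-one-<ᵇ {zero}  {zero}  a≢b = ⊥-elim (a≢b refl)
exactly-one-<ᵇ {zero}  {suc b} _   = refl
exactly-one-<ᵇ {suc a} {zero}  _   = refl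
exactly-one-<ᵇ {suc a} {suc b} a≢b = exactly-one-<ᵇ (a≢b ∘ cong suc)

TwoNeighbours : ∀ {n} → (Fin n → Fin n → Bool) → Fin n → Set
TwoNeighbours r u = ∃₂ λ y z → y ≢ z × r u y ≡ true × r u z ≡ true

module _ {n} (G : Graph n) where

  adj⇒≢ : ∀ {u v} → adj G u v ≡ true → u ≢ v
  adj⇒≢ {u} uv refl = case trans (sym uv) (irrefl G u) of λ ()

  adj-symmetric : ∀ {u v} → adj G u v ≡ true → adj G v u ≡ true
  adj-symmetric {u} {v} uv = trans (adj-sym G v u) uv

  degree : Fin n → ℕ
  degree u = count (adj G u)

  forward : Fin n → Fin n → Bool
  forward u v = adj G u v ∧ (toℕ u <ᵇ toℕ v)

  edgeCount : ℕ
  edgeCount = ∑[ u < n ] count (forward u)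

  adj-forward : ∀ u v → 𝟙 (adj G u v) ≡ 𝟙 (forward u v) + 𝟙 (forward v u)
  adj-forward u v rewrite adj-sym G v u with adj G u v in uv
  ... | false = refl
  ... | true  = sym (exactly-one-<ᵇ (adj⇒≢ uv ∘ toℕ-injective))

  handshake : ∑[ u < n ] degree u ≡ 2 * edgeCount
  handshake = begin
    ∑[ u < n ] degree u
      ≡⟨ sum-cong-≗ {x = degree} (λ u → sum-cong-≗ {x = λ v → 𝟙 (adj G u v)} (adj-forward u)) ⟩
    ∑[ u < n ] ∑[ v < n ] (𝟙 (forward u v) + 𝟙 (forward v u))
      ≡⟨ sum-cong-≗ (λ u → ∑-distrib-+ (λ v → 𝟙 (forward u v)) (λ v → 𝟙 (forward v u))) ⟩
    ∑[ u < n ] (count (forward u) + ∑[ v < n ] 𝟙 (forward v u))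
      ≡⟨ ∑-distrib-+ (λ u → count (forward u)) (λ u → ∑[ v < n ] 𝟙 (forward v u)) ⟩
    edgeCount + ∑[ u < n ] ∑[ v < n ] 𝟙 (forward v u)
      ≡⟨ cong (edgeCount +_) (∑-comm (λ u v → 𝟙 (forward v u))) ⟩
    edgeCount + edgeCount
      ≡⟨ cong (edgeCount +_) (+-identityʳ edgeCount) ⟨
    2 * edgeCount ∎
    where open ≡-Reasoning

  regular-handshake : ∀ {d} → (∀ u → degree u ≡ d) → 2 * edgeCount ≡ n * d
  regular-handshake {d} degree≡d = trans (sym handshake) (trans (sum-cong-≗ degree≡d) (∑-const n d))

  two-neighbours⇒2≤degree : ∀ {u} → TwoNeighbours (adj G) u → 2 ≤ degree u
  two-neighbours⇒2≤degree (_ , _ , y≢z , uy , uz) =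
    distinct≤count (adj G _) ((y≢z ∷ []) ∷ [] ∷ []) (uy ∷ uz ∷ [])

  degree≤2⇒neighbour-is-one-of : ∀ {u y z w} → degree u ≤ 2 → y ≢ z →
    adj G u y ≡ true → adj G u z ≡ true → adj G u w ≡ true → w ≡ y ⊎ w ≡ z
  degree≤2⇒neighbour-is-one-of {u} {y} {z} {w} deg≤2 y≢z uy uz uw with w ≟ y | w ≟ z
  ... | yes w≡y | _       = inj₁ w≡y
  ... | no _    | yes w≡z = inj₂ w≡z
  ... | no w≢y  | no w≢z  = contradiction
        (distinct≤count (adj G u) ((y≢z ∷ w≢y ∘ sym ∷ []) ∷ (w≢z ∘ sym ∷ []) ∷ [] ∷ []) (uy ∷ uz ∷ uw ∷ []))
        (<⇒≱ (s≤s deg≤2))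

  module _ (2≤degree : ∀ u → 2 ≤ degree u) where

    n≤edgeCount : n ≤ edgeCount
    n≤edgeCount = *-cancelˡ-≤ 2 (begin
      2 * n               ≡⟨ *-comm 2 n ⟩
      n * 2               ≡⟨ ∑-const n 2 ⟨
      ∑[ u < n ] 2        ≤⟨ ∑-mono-≤ 2≤degree ⟩
      ∑[ u < n ] degree u ≡⟨ handshake ⟩
      2 * edgeCount       ∎)
      where open ≤-Reasoning

    edgeCount≡n⇒degree≡2 : edgeCount ≡ n → ∀ u → degree u ≡ 2
    edgeCount≡n⇒degree≡2 edges≡n u = sym (∑-≤-tight 2≤degree (begin
      ∑[ u < n ] 2        ≡⟨ ∑-const n 2 ⟩
      n * 2               ≡⟨ *-comm n 2 ⟩
      2 * n               ≡⟨ cong (2 *_) edges≡n ⟨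
      2 * edgeCount       ≡⟨ handshake ⟨
      ∑[ u < n ] degree u ∎) u)
      where open ≡-Reasoning

  module _ {e} (ecc≡e : ∀ v → ecc G v ≡ e) where

    E₁-constant-ecc : E₁ G ≡ e * e * n
    E₁-constant-ecc = begin
      E₁ G                           ≡⟨ sum-map-allFin (λ v → ecc G v * ecc G v) ⟩
      ∑[ v < n ] (ecc G v * ecc G v) ≡⟨ sum-cong-≗ (λ v → cong₂ _*_ (ecc≡e v) (ecc≡e v)) ⟩
      ∑[ v < n ] (e * e)             ≡⟨ ∑-const n (e * e) ⟩
      n * (e * e)                    ≡⟨ *-comm n (e * e) ⟩
      e * e * n                      ∎
      where open ≡-Reasoning

    E₂-constant-ecc : E₂ G ≡ e * e * edgeCount
    E₂-constant-ecc = begin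
      E₂ G                                     ≡⟨ sum-map-allFin (λ u → sum (map (term u) (allFin n))) ⟩
      ∑[ u < n ] sum (map (term u) (allFin n)) ≡⟨ sum-cong-≗ (λ u → sum-map-allFin (term u)) ⟩
      ∑[ u < n ] ∑[ v < n ] term u v           ≡⟨ sum-cong-≗ (λ u → sum-cong-≗ (term≡ u)) ⟩
      ∑[ u < n ] ∑[ v < n ] (e * e * 𝟙 (forward u v))
        ≡⟨ sum-cong-≗ (λ u → *-distribˡ-sum (e * e) (λ v → 𝟙 (forward u v))) ⟨
      ∑[ u < n ] (e * e * count (forward u))   ≡⟨ *-distribˡ-sum (e * e) (λ u → count (forward u)) ⟨
      e * e * edgeCount                        ∎
      where
      open ≡-Reasoning
      term : Fin n → Fin n → ℕ
      term u v = if forward u v then ecc G u * ecc G v else 0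
      term≡ : ∀ u v → term u v ≡ e * e * 𝟙 (forward u v)
      term≡ u v with forward u v
      ... | true  = trans (cong₂ _*_ (ecc≡e u) (ecc≡e v)) (sym (*-identityʳ (e * e)))
      ... | false = sym (*-zeroʳ (e * e))

module _ {n} (G : Graph n) where

  data WithinTwo (v : Fin n) : Fin n → Set where
    same    : WithinTwo v v
    edge    : ∀ {u} → adj G v u ≡ true → WithinTwo v u
    twoStep : ∀ {u} w → adj G v w ≡ true → adj G w u ≡ true → WithinTwo v u

  reach-refl : ∀ v → reach G 0 v v ≡ true
  reach-refl v = Equivalence.to T-≡ (≡⇒≡ᵇ (toℕ v) (toℕ v) refl)

  reach-zero⁻ : ∀ u v → reach G 0 u v ≡ true → u ≡ v
  reach-zero⁻ u v r = toℕ-injective (≡ᵇ⇒≡ (toℕ u) (toℕ v) (Equivalence.from T-≡ r))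

  reach-suc⁺ : ∀ k u v → reach G k u v ≡ true → reach G (suc k) u v ≡ true
  reach-suc⁺ k u v r rewrite r = refl

  reach-suc⁻ : ∀ k u v → reach G (suc k) u v ≡ true →
               reach G k u v ≡ true ⊎ ∃[ w ] reach G k u w ≡ true × adj G w v ≡ true
  reach-suc⁻ k u v r with reach G k u v
  ... | true  = inj₁ refl
  ... | false = inj₂ (Product.map₂ split (satisfied (any⁻ _ (vertices G) (Equivalence.from T-≡ r))))
    where
    split : ∀ {w} → T (reach G k u w ∧ adj G w v) → reach G k u w ≡ true × adj G w v ≡ true
    split = Product.map (Equivalence.to T-≡) (Equivalence.to T-≡) ∘ Equivalence.to T-∧

  reach-≤⁺ : ∀ {k l} u v → k ≤ l → reach G k u v ≡ true → reach G l u v ≡ true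
  reach-≤⁺ {l = zero}  u v z≤n r = r
  reach-≤⁺ {l = suc l} u v k≤1+l r with m≤n⇒m<n∨m≡n k≤1+l
  ... | inj₁ k<1+l = reach-suc⁺ l u v (reach-≤⁺ u v (≤-pred k<1+l) r)
  ... | inj₂ refl  = r

  reach-adj : ∀ u v → adj G u v ≡ true → reach G 1 u v ≡ true
  reach-adj u v uv = trans (cong (reach G 0 u v ∨_) any-true) (∨-zeroʳ _)
    where
    any-true : any (λ w → reach G 0 u w ∧ adj G w v) (vertices G) ≡ true
    any-true = Equivalence.to T-≡ (any⁺ _ (Any.map (λ { refl → Equivalence.from T-≡
                 (cong₂ _∧_ (reach-refl u) uv) }) (∈-allFin u)))

  reach-one⁻ : ∀ u v → reach G 1 u v ≡ true → u ≡ v ⊎ adj G u v ≡ true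
  reach-one⁻ u v r with reach-suc⁻ 0 u v r
  ... | inj₁ r₀            = inj₁ (reach-zero⁻ u v r₀)
  ... | inj₂ (w , r₀ , wv) = inj₂ (subst (λ x → adj G x v ≡ true) (sym (reach-zero⁻ u w r₀)) wv)

  reach-two⁻ : ∀ u v → reach G 2 u v ≡ true → WithinTwo u v
  reach-two⁻ u v r with reach-suc⁻ 1 u v r
  ... | inj₁ r₁ with reach-one⁻ u v r₁
  ...   | inj₁ refl = same
  ...   | inj₂ uv   = edge uv
  reach-two⁻ u v r | inj₂ (w , r₁ , wv) with reach-one⁻ u w r₁
  ...   | inj₁ refl = edge wv
  ...   | inj₂ uw   = twoStep w uw wv

  reach-has-neighbour : ∀ k u v → reach G k u v ≡ true → u ≢ v → ∃[ w ] adj G w v ≡ true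
  reach-has-neighbour zero    u v r u≢v = ⊥-elim (u≢v (reach-zero⁻ u v r))
  reach-has-neighbour (suc k) u v r u≢v with reach-suc⁻ k u v r
  ... | inj₁ r′           = reach-has-neighbour k u v r′ u≢v
  ... | inj₂ (w , _ , wv) = w , wv

  dist-refl : ∀ v → dist G v v ≡ 0
  dist-refl v = n≤0⇒n≡0 (μ-≤ _ n (reach-refl v))

  dist-adj : ∀ u v → adj G u v ≡ true → dist G u v ≤ 1
  dist-adj u v uv = μ-≤ _ n (reach-adj u v uv)

  reach-dist : ∀ u v → dist G u v < n → reach G (dist G u v) u v ≡ true
  reach-dist u v = μ-found _ n

  dist≤ecc : ∀ v u → dist G v u ≤ ecc G v
  dist≤ecc v u = ≤-max-map (dist G v) (∈-allFin u)

  ecc-attained : ∀ v → ecc G v ≡ 0 ⊎ ∃[ u ] ecc G v ≡ dist G v u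
  ecc-attained v with foldr-selective ⊔-sel 0 (map (dist G v) (vertices G))
  ... | inj₁ ecc≡0 = inj₁ ecc≡0
  ... | inj₂ ecc∈  = let u , _ , ecc≡ = ∈-map⁻ (dist G v) ecc∈ in inj₂ (u , ecc≡)

  self-centered⇒ecc≡diam : SelfCentered G → ∀ v → ecc G v ≡ diam G
  self-centered⇒ecc≡diam diam≡rad v = ≤-antisym (≤-max-map (ecc G) (∈-allFin v))
    (subst (_≤ ecc G v) (sym diam≡rad) (min-map-≤ (ecc G) (diam G) (∈-allFin v)))

  module _ (ecc≡2 : ∀ v → ecc G v ≡ 2) where

    far-vertex : ∀ v → ∃[ u ] v ≢ u × adj G v u ≢ true
    far-vertex v with ecc-attained v
    ... | inj₁ ecc≡0          = case trans (sym (ecc≡2 v)) ecc≡0 of λ ()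
    ... | inj₂ (u , ecc≡dist) = u , v≢u , v≁u
      where
      dist≡2 : dist G v u ≡ 2
      dist≡2 = trans (sym ecc≡dist) (ecc≡2 v)
      v≢u : v ≢ u
      v≢u refl = case trans (sym dist≡2) (dist-refl v) of λ ()
      v≁u : adj G v u ≢ true
      v≁u vu = <⇒≱ (≤-reflexive (sym dist≡2)) (dist-adj v u vu)

    module _ (connected : Connected G) where

      three≤n : Fin n → 3 ≤ n
      three≤n v with far-vertex v
      ... | u , v≢u , v≁u with connected v u
      ...   | k , r with reach-has-neighbour k v u r v≢u
      ...     | w , wu = subst (3 ≤_) (count-true n)
                  (distinct≤count (λ _ → true) ((v≢u ∷ v≢w ∷ []) ∷ (adj⇒≢ G wu ∘ sym ∷ []) ∷ [] ∷ [])
                    (refl ∷ refl ∷ refl ∷ []))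
        where
        v≢w : v ≢ w
        v≢w refl = v≁u wu

      -- dist is a search bounded by n, so it certifies a walk only below n
      within-two : ∀ v u → WithinTwo v u
      within-two v u = reach-two⁻ v u (reach-≤⁺ v u dist≤2
                         (reach-dist v u (≤-<-trans dist≤2 (three≤n v))))
        where
        dist≤2 : dist G v u ≤ 2
        dist≤2 = subst (dist G v u ≤_) (ecc≡2 v) (dist≤ecc v u)

      two-neighbours : ∀ v → TwoNeighbours (adj G) v
      two-neighbours v with far-vertex v
      ... | u , v≢u , v≁u with within-two v u
      ...   | same               = ⊥-elim (v≢u refl)
      ...   | edge vu            = ⊥-elim (v≁u vu)
      ...   | twoStep w vw wu with far-vertex w
      ...     | x , w≢x , w≁x with within-two v x
      ...       | same            = ⊥-elim (w≁x (adj-symmetric G vw))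
      ...       | edge vx         = w , x , w≢x , vw , vx
      ...       | twoStep y vy yx = w , y , (λ { refl → w≁x yx }) , vw , vy

next : ∀ {k} .{{_ : NonZero k}} → Fin k → Fin k
next {k} i = suc (toℕ i) mod k

module _ (k : ℕ) .{{_ : NonZero k}} where

  cycAdj-via-next? : Dec (∀ i j → cycAdj k i j ≡ true → j ≡ next i ⊎ i ≡ next j)
  cycAdj-via-next? = all? λ i → all? λ j → (cycAdj k i j ≟ᵇ true) →-dec ((j ≟ next i) ⊎-dec (i ≟ next j))

  cycle-two-neighbours? : Dec (∀ i → TwoNeighbours (cycAdj k) i)
  cycle-two-neighbours? = all? λ i → any? λ y → any? λ z →
    ¬? (y ≟ z) ×-dec (cycAdj k i y ≟ᵇ true) ×-dec (cycAdj k i z ≟ᵇ true)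

  cycle-degree? : Dec (∀ i → count (cycAdj k i) ≡ 2)
  cycle-degree? = all? λ i → count (cycAdj k i) ≟ℕ 2

module _ {n} (G : Graph n) where

  -- an edge of G outside h would be a third neighbour
  two-neighbour-subgraph≡ : (h : Fin n → Fin n → Bool) → (∀ u v → h u v ≡ true → adj G u v ≡ true) →
    (∀ u → TwoNeighbours h u) → (∀ u → degree G u ≤ 2) → ∀ u v → adj G u v ≡ h u v
  two-neighbour-subgraph≡ h h⊆G two deg≤2 u v with h u v in uv
  ... | true  = h⊆G u v uv
  ... | false with adj G u v in G-uv
  ...   | false = refl
  ...   | true with two u
  ...     | y , z , y≢z , uy , uz
              with degree≤2⇒neighbour-is-one-of G (deg≤2 u) y≢z (h⊆G u y uy) (h⊆G u z uz) G-uv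
  ...       | inj₁ refl = trans (sym uy) uv
  ...       | inj₂ refl = trans (sym uz) uv

  module _ {k} .{{_ : NonZero k}} (f : Fin n ↔ Fin k) where
    open Inverse f

    cycle-iso : (∀ i → adj G (from i) (from (next i)) ≡ true) →
      (∀ i j → cycAdj k i j ≡ true → j ≡ next i ⊎ i ≡ next j) → (∀ i → TwoNeighbours (cycAdj k) i) →
      (∀ u → degree G u ≤ 2) → IsoCycle G k
    cycle-iso edges via-next cycle-two deg≤2 =
      f , two-neighbour-subgraph≡ (λ u v → cycAdj k (to u) (to v)) cycle⊆G two deg≤2
      where
      edge-to-next : ∀ u v → to v ≡ next (to u) → adj G u v ≡ true
      edge-to-next u v eq = subst₂ (λ x y → adj G x y ≡ true) (strictlyInverseʳ u)
        (trans (cong from (sym eq)) (strictlyInverseʳ v)) (edges (to u))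
      cycle⊆G : ∀ u v → cycAdj k (to u) (to v) ≡ true → adj G u v ≡ true
      cycle⊆G u v uv with via-next (to u) (to v) uv
      ... | inj₁ v-next = edge-to-next u v v-next
      ... | inj₂ u-next = adj-symmetric G (edge-to-next v u u-next)
      from-injective : ∀ {i j} → from i ≡ from j → i ≡ j
      from-injective {i} {j} eq = trans (sym (strictlyInverseˡ i)) (trans (cong to eq) (strictlyInverseˡ j))
      two : ∀ u → TwoNeighbours (λ u v → cycAdj k (to u) (to v)) u
      two u with cycle-two (to u)
      ... | y , z , y≢z , uy , uz = from y , from z , y≢z ∘ from-injective ,
        subst (λ x → cycAdj k (to u) x ≡ true) (sym (strictlyInverseˡ y)) uy ,
        subst (λ x → cycAdj k (to u) x ≡ true) (sym (strictlyInverseˡ z)) uz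

  IsoCycle⇒degree≡ : ∀ {k} → ((f , _) : IsoCycle G k) → ∀ u → degree G u ≡ count (cycAdj k (Inverse.to f u))
  IsoCycle⇒degree≡ {k} (f , G≅C) u = trans (sum-cong-≗ (λ v → cong 𝟙 (G≅C u v)))
    (sym (∑-permute (λ j → 𝟙 (cycAdj k (to u) j)) f))
    where open Inverse f

  C₄⊎C₅⇒degree≡2 : IsoCycle G 4 ⊎ IsoCycle G 5 → ∀ u → degree G u ≡ 2
  C₄⊎C₅⇒degree≡2 (inj₁ C₄) u =
    trans (IsoCycle⇒degree≡ C₄ u) (toWitness {a? = cycle-degree? 4} _ (Inverse.to (proj₁ C₄) u))
  C₄⊎C₅⇒degree≡2 (inj₂ C₅) u =
    trans (IsoCycle⇒degree≡ C₅ u) (toWitness {a? = cycle-degree? 5} _ (Inverse.to (proj₁ C₅) u))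

module _ {n} (G : Graph n)
         (within-two : ∀ v u → WithinTwo G v u)
         (far-vertex : ∀ v → ∃[ u ] v ≢ u × adj G v u ≢ true)
         (two-neighbours : ∀ v → TwoNeighbours (adj G) v)
         (degree≤2 : ∀ v → degree G v ≤ 2)
  where

  private
    other-neighbour : ∀ {x u} → adj G x u ≡ true → ∃[ w ] w ≢ u × adj G x w ≡ true
    other-neighbour {u = u} _ with two-neighbours _
    ... | y , z , y≢z , xy , xz with y ≟ u
    ...   | yes refl = z , y≢z ∘ sym , xz
    ...   | no y≢u   = y , y≢u , xy

    module Configuration {v a b a′ b′ : Fin n} (a≢b : a ≢ b) (va : adj G v a ≡ true) (vb : adj G v b ≡ true)
      (a′≢v : a′ ≢ v) (aa′ : adj G a a′ ≡ true) (b′≢v : b′ ≢ v) (bb′ : adj G b b′ ≡ true) where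

      one-of : ∀ {x y z w} → y ≢ z → adj G x y ≡ true → adj G x z ≡ true → adj G x w ≡ true → w ≡ y ⊎ w ≡ z
      one-of = degree≤2⇒neighbour-is-one-of G (degree≤2 _)

      neighbour-of-v : ∀ {w} → adj G v w ≡ true → w ≡ a ⊎ w ≡ b
      neighbour-of-v = one-of a≢b va vb

      neighbour-of-a : ∀ {w} → adj G a w ≡ true → w ≡ v ⊎ w ≡ a′
      neighbour-of-a = one-of (a′≢v ∘ sym) (adj-symmetric G va) aa′

      neighbour-of-b : ∀ {w} → adj G b w ≡ true → w ≡ v ⊎ w ≡ b′
      neighbour-of-b = one-of (b′≢v ∘ sym) (adj-symmetric G vb) bb′

      covered : ∀ u → u ∈ v ∷ a ∷ a′ ∷ b′ ∷ b ∷ []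
      covered u with within-two v u
      ... | same = here refl
      ... | edge vu with neighbour-of-v vu
      ...   | inj₁ refl = there (here refl)
      ...   | inj₂ refl = there (there (there (there (here refl))))
      covered u | twoStep w vw wu with neighbour-of-v vw
      ...   | inj₁ refl = [ (λ { refl → here refl }) , (λ { refl → there (there (here refl)) }) ]′
                            (neighbour-of-a wu)
      ...   | inj₂ refl = [ (λ { refl → here refl }) , (λ { refl → there (there (there (here refl))) }) ]′
                            (neighbour-of-b wu)

      -- with a triangle v a b, every vertex would be v or adjacent to v
      a′≢b : a′ ≢ b
      a′≢b refl with far-vertex v
      ... | u , v≢u , v≁u with covered u
      ... | here refl                                = v≢u refl
      ... | there (here refl)                        = v≁u va
      ... | there (there (here refl))                = v≁u vb
      ... | there (there (there (here refl)))        =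
            [ adj⇒≢ G va ∘ sym , (λ { refl → v≁u va }) ]′ (neighbour-of-b (adj-symmetric G aa′))
      ... | there (there (there (there (here refl)))) = v≁u vb

      b′≢a : b′ ≢ a
      b′≢a refl = [ adj⇒≢ G vb ∘ sym , a′≢b ∘ sym ]′ (neighbour-of-a (adj-symmetric G bb′))

      a′~b′ : a′ ≢ b′ → adj G a′ b′ ≡ true
      a′~b′ a′≢b′ with within-two a′ b′
      ... | same      = ⊥-elim (a′≢b′ refl)
      ... | edge a′b′ = a′b′
      ... | twoStep w a′w wb′ with covered w
      ...   | here refl                                =
              ⊥-elim ([ b′≢a , adj⇒≢ G bb′ ∘ sym ]′ (neighbour-of-v wb′))
      ...   | there (here refl)                        =
              ⊥-elim ([ b′≢v , a′≢b′ ∘ sym ]′ (neighbour-of-a wb′))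
      ...   | there (there (here refl))                = ⊥-elim (adj⇒≢ G a′w refl)
      ...   | there (there (there (here refl)))        = ⊥-elim (adj⇒≢ G wb′ refl)
      ...   | there (there (there (there (here refl)))) =
              ⊥-elim ([ a′≢v , a′≢b′ ]′ (neighbour-of-b (adj-symmetric G a′w)))

      cycle-4-or-5 : IsoCycle G 4 ⊎ IsoCycle G 5
      cycle-4-or-5 with a′ ≟ b′
      ... | yes refl = inj₁ (cycle-iso G (enumeration (v ∷ a ∷ a′ ∷ b ∷ []) distinct covered₄)
            (λ { 0F → va ; 1F → aa′ ; 2F → adj-symmetric G bb′ ; 3F → adj-symmetric G vb })
            (toWitness {a? = cycAdj-via-next? 4} _) (toWitness {a? = cycle-two-neighbours? 4} _) degree≤2)
        where
        distinct : Unique (v ∷ a ∷ a′ ∷ b ∷ [])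
        distinct = (adj⇒≢ G va ∷ a′≢v ∘ sym ∷ adj⇒≢ G vb ∷ [])
                 ∷ (adj⇒≢ G aa′ ∷ a≢b ∷ []) ∷ (a′≢b ∷ []) ∷ [] ∷ []
        covered₄ : ∀ u → u ∈ v ∷ a ∷ a′ ∷ b ∷ []
        covered₄ u with covered u
        ... | here u≡v                          = here u≡v
        ... | there (here u≡a)                  = there (here u≡a)
        ... | there (there (here u≡a′))         = there (there (here u≡a′))
        ... | there (there (there (here u≡a′))) = there (there (here u≡a′))
        ... | there (there (there (there u∈b))) = there (there (there u∈b))
      ... | no a′≢b′ = inj₂ (cycle-iso G (enumeration (v ∷ a ∷ a′ ∷ b′ ∷ b ∷ []) distinct covered)
            (λ { 0F → va ; 1F → aa′ ; 2F → a′~b′ a′≢b′ ; 3F → adj-symmetric G bb′ ; 4F → adj-symmetric G vb })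
            (toWitness {a? = cycAdj-via-next? 5} _) (toWitness {a? = cycle-two-neighbours? 5} _) degree≤2)
        where
        distinct : Unique (v ∷ a ∷ a′ ∷ b′ ∷ b ∷ [])
        distinct = (adj⇒≢ G va ∷ a′≢v ∘ sym ∷ b′≢v ∘ sym ∷ adj⇒≢ G vb ∷ [])
                 ∷ (adj⇒≢ G aa′ ∷ b′≢a ∘ sym ∷ a≢b ∷ []) ∷ (a′≢b′ ∷ a′≢b ∷ [])
                 ∷ (adj⇒≢ G bb′ ∘ sym ∷ []) ∷ [] ∷ []

  two-regular-diameter-two⇒C₄⊎C₅ : Fin n → IsoCycle G 4 ⊎ IsoCycle G 5
  two-regular-diameter-two⇒C₄⊎C₅ v with two-neighbours v
  ... | a , b , a≢b , va , vb with other-neighbour (adj-symmetric G va) | other-neighbour (adj-symmetric G vb)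
  ...   | a′ , a′≢v , aa′ | b′ , b′≢v , bb′ = Configuration.cycle-4-or-5 a≢b va vb a′≢v aa′ b′≢v bb′

corollary2p2 : ∀ {n : ℕ} (G : Graph n) → Connected G → SelfCentered G → diam G ≡ 2 →
    (E₁ G ≤ E₂ G) × ((E₂ G ≡ E₁ G) ⇔ (IsoCycle G 4 ⊎ IsoCycle G 5))
corollary2p2 {zero}  G _ _ ()
corollary2p2 {suc m} G connected self-centered diam≡2 =
  subst₂ _≤_ (sym E₁≡) (sym E₂≡) (*-monoʳ-≤ 4 (n≤edgeCount G 2≤degree)) ,
  mk⇔ E₂≡E₁⇒C₄⊎C₅ C₄⊎C₅⇒E₂≡E₁
  where
  ecc≡2 : ∀ v → ecc G v ≡ 2
  ecc≡2 v = trans (self-centered⇒ecc≡diam G self-centered v) diam≡2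
  E₁≡ : E₁ G ≡ 4 * suc m
  E₁≡ = E₁-constant-ecc G ecc≡2
  E₂≡ : E₂ G ≡ 4 * edgeCount G
  E₂≡ = E₂-constant-ecc G ecc≡2
  2≤degree : ∀ u → 2 ≤ degree G u
  2≤degree u = two-neighbours⇒2≤degree G (two-neighbours G ecc≡2 connected u)
  E₂≡E₁⇒C₄⊎C₅ : E₂ G ≡ E₁ G → IsoCycle G 4 ⊎ IsoCycle G 5
  E₂≡E₁⇒C₄⊎C₅ E₂≡E₁ = two-regular-diameter-two⇒C₄⊎C₅ G (within-two G ecc≡2 connected) (far-vertex G ecc≡2)
    (two-neighbours G ecc≡2 connected) (≤-reflexive ∘ edgeCount≡n⇒degree≡2 G 2≤degree edges≡n) 0F
    where
    edges≡n : edgeCount G ≡ suc m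
    edges≡n = *-cancelˡ-≡ _ _ 4 (trans (sym E₂≡) (trans E₂≡E₁ E₁≡))
  C₄⊎C₅⇒E₂≡E₁ : IsoCycle G 4 ⊎ IsoCycle G 5 → E₂ G ≡ E₁ G
  C₄⊎C₅⇒E₂≡E₁ cycle = trans E₂≡ (trans (cong (4 *_) edges≡n) (sym E₁≡))
    where
    edges≡n : edgeCount G ≡ suc m
    edges≡n = *-cancelˡ-≡ _ _ 2 (trans (regular-handshake G (C₄⊎C₅⇒degree≡2 G cycle)) (*-comm (suc m) 2))
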